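{- Let $G$ be a cop-win graph of corner rank $\alpha\ge2$. No vertex of corner rank $\alpha-1$ is adjacent to every vertex of corner rank $\alpha-1$.
   Context: All graphs are finite, nonempty, simple and reflexive (each vertex is adjacent to itself). Corner ranking: $N[v]$ is the closed neighborhood. In a graph $H$, $w$ strictly corners a distinct vertex $v$ if $N[v]\subsetneq N[w]$. Set $G^{(1)}=G$, $k=1$. If $G^{(k)}$ is a clique, give its vertices rank $k$ and stop; else if it has no strict corners, give its vertices rank $\infty$ and stop; else give all strict corners of $G^{(k)}$ rank $k$, delete them to get $G^{(k+1)}$, increase $k$, repeat. The corner rank of $G$ is the largest vertex rank; cop-win graphs are those with finite corner rank. -}

module Defs where

open import Data.Bool using (Bool; true; false; _∧_; _∨_; not; if_then_else_)
open import Data.Nat using (ℕ; zero; suc; _≤_; _⊔_)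
open import Data.Fin using (Fin)
open import Data.List using (List; allFin; map; foldr)
open import Data.Bool.ListAction using (all; any)
open import Data.Product using (Σ)
open import Relation.Binary.PropositionalEquality using (_≡_)

record Graph (n : ℕ) : Set where
  field
    adj      : Fin n → Fin n → Bool
    adj-refl : ∀ v → adj v v ≡ true
    adj-sym  : ∀ u v → adj u v ≡ adj v u
open Graph public

data Rank : Set where
  fin : ℕ → Rank
  ∞   : Rank

maxR : Rank → Rank → Rank
maxR (fin a) (fin b) = fin (a ⊔ b)
maxR _ _ = ∞

-- Vertex subsets (the surviving vertices; induced subgraph G[S]).
Subset : ℕ → Set
Subset n = Fin n → Bool

module _ {n : ℕ} (G : Graph n) where

  -- u ∈ N[v] in the induced subgraph G[S]  (v assumed in S)
  inN : Subset n → Fin n → Fin n → Bool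
  inN S v u = S u ∧ adj G v u

  nbhdSub : Subset n → Fin n → Fin n → Bool
  nbhdSub S v w = all (λ u → not (inN S v u) ∨ inN S w u) (allFin n)

  strictlyCorners : Subset n → Fin n → Fin n → Bool
  strictlyCorners S w v = nbhdSub S v w ∧ not (nbhdSub S w v)

  isStrictCorner : Subset n → Fin n → Bool
  isStrictCorner S v = S v ∧ any (λ w → S w ∧ strictlyCorners S w v) (allFin n)

  isClique : Subset n → Bool
  isClique S = all (λ u → all (λ v → not (S u ∧ S v) ∨ adj G u v) (allFin n)) (allFin n)

  hasStrictCorner : Subset n → Bool
  hasStrictCorner S = any (isStrictCorner S) (allFin n)

  -- The corner-ranking process, with fuel, started at stage k on G[S]
  -- (S = vertex set of G^(k)); queried vertex v is assumed to lie in S.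
  rankFrom : ℕ → ℕ → Subset n → Fin n → Rank
  rankFrom zero     k S v = ∞
  rankFrom (suc f) k S v =
    if isClique S then fin k
    else if not (hasStrictCorner S) then ∞
    else if isStrictCorner S v then fin k
    else rankFrom f (suc k) (λ u → S u ∧ not (isStrictCorner S u)) v

  rank : Fin n → Rank
  rank v = rankFrom (suc n) 1 (λ _ → true) v

  cornerRank : Rank
  cornerRank = foldr maxR (fin 0) (map rank (allFin n))

  CopWin : Set
  CopWin = Σ ℕ (λ α → cornerRank ≡ fin α)

-- Let α ≥ 2 be the corner rank and let v have rank a = α − 1, so v is a strict
-- corner of S = G^(a). Every vertex of rank α survives into G^(α), and since no
-- vertex has rank above α, G^(α) (the set of non-corners of S) is a clique K.
-- Suppose v were adjacent to all strict corners of S. Following strict corners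
-- upwards from a vertex strictly cornering v reaches some w ∈ K with N[v] ⊆ N[w];
-- then w is adjacent to all corners and to all of K, i.e. w is universal in S.
-- A non-corner x of S satisfies N[x] ⊆ N[w] and hence N[x] = N[w], so every
-- vertex of K is universal too. Thus v is universal in S, which contradicts v
-- being strictly cornered.
module Submission where

open import Defs
open import Data.Bool using (Bool; true; false; _∧_; _∨_; not; _≟_)
open import Data.Bool.Properties using (¬-not)
open import Data.Bool.ListAction using (all; any)
open import Data.Empty using (⊥-elim)
open import Data.Fin using (Fin)
open import Data.Fin.Properties using (any?)
open import Data.Fin.Subset as Sub using (_∈_; _⊂_; ∣_∣)
open import Data.Fin.Subset.Properties using (p⊂q⇒∣p∣<∣q∣; ∣p∣≤n)
open import Data.List using ([]; _∷_; allFin; map; foldr)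
open import Data.List.Membership.Propositional.Properties using (∈-allFin)
open import Data.List.Relation.Unary.All as All using (All; []; _∷_)
open import Data.Nat using (ℕ; zero; suc; _≤_; _<_; _∸_; _⊔_; z≤n; s≤s)
open import Data.Nat.Induction using (<-wellFounded)
open import Data.Nat.Properties
  using (≤-reflexive; ≤-trans; <⇒≤; <-irrefl; 1+n≢n; 1+n≰n; n≤1+n; ∸-monoʳ-<; ⊔-sel; m≤m⊔n; m≤n⊔m)
open import Data.Product using (Σ; ∃; _×_; _,_; proj₁; proj₂)
open import Data.Sum using (_⊎_; inj₁; inj₂)
open import Data.Vec using (tabulate)
open import Data.Vec.Properties using (lookup∘tabulate; []=⇒lookup; lookup⇒[]=)
open import Function using (_on_)
open import Induction.WellFounded using (Acc; acc)
open import Relation.Binary.Construct.On as On using ()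
open import Relation.Binary.PropositionalEquality using (_≡_; refl; sym; trans; cong; cong₂; subst)
open import Relation.Nullary using (¬_; yes; no)
open import Relation.Nullary.Decidable using (_×-dec_)

true-or-false : ∀ b → b ≡ true ⊎ b ≡ false
true-or-false true  = inj₁ refl
true-or-false false = inj₂ refl

∧-true⁻ : ∀ {a b} → a ∧ b ≡ true → a ≡ true × b ≡ true
∧-true⁻ {true} {true} refl = refl , refl

∧-false⁻ : ∀ {a b} → a ∧ b ≡ false → a ≡ false ⊎ b ≡ false
∧-false⁻ {false} refl = inj₁ refl
∧-false⁻ {true}  refl = inj₂ refl

true-∧-false⁻ : ∀ {a b} → a ≡ true → a ∧ b ≡ false → b ≡ false
true-∧-false⁻ refl e = e

∨-true⁻ : ∀ {a b} → a ∨ b ≡ true → a ≡ true ⊎ b ≡ true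
∨-true⁻ {true}  refl = inj₁ refl
∨-true⁻ {false} refl = inj₂ refl

∨-false⁻ : ∀ {a b} → a ∨ b ≡ false → a ≡ false × b ≡ false
∨-false⁻ {false} {false} refl = refl , refl

≡true⇒≢false : ∀ {b} → b ≡ true → ¬ (b ≡ false)
≡true⇒≢false refl ()

not-true⁻ : ∀ {b} → not b ≡ true → b ≡ false
not-true⁻ {false} refl = refl

not-false⁻ : ∀ {b} → not b ≡ false → b ≡ true
not-false⁻ {true} refl = refl

⇒-true⁻ : ∀ {a b} → not a ∨ b ≡ true → a ≡ true → b ≡ true
⇒-true⁻ e refl = e

⇒-true⁺ : ∀ {a b} → (a ≡ true → b ≡ true) → not a ∨ b ≡ true
⇒-true⁺ {false} f = refl
⇒-true⁺ {true}  f = f refl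

⇒-false⁻ : ∀ {a b} → not a ∨ b ≡ false → a ≡ true × b ≡ false
⇒-false⁻ e with ∨-false⁻ e
... | na , b = not-false⁻ na , b

module _ {A : Set} {p : A → Bool} where

  all-true⁻ : ∀ xs → all p xs ≡ true → All (λ x → p x ≡ true) xs
  all-true⁻ []     _ = []
  all-true⁻ (x ∷ xs) e with ∧-true⁻ e
  ... | px , pxs = px ∷ all-true⁻ xs pxs

  all-true⁺ : ∀ xs → (∀ x → p x ≡ true) → all p xs ≡ true
  all-true⁺ []     _ = refl
  all-true⁺ (x ∷ xs) f = cong₂ _∧_ (f x) (all-true⁺ xs f)

  all-false⁻ : ∀ xs → all p xs ≡ false → ∃ λ x → p x ≡ false
  all-false⁻ (x ∷ xs) e with ∧-false⁻ e
  ... | inj₁ px  = x , px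
  ... | inj₂ pxs = all-false⁻ xs pxs

  any-true⁻ : ∀ xs → any p xs ≡ true → ∃ λ x → p x ≡ true
  any-true⁻ (x ∷ xs) e with ∨-true⁻ e
  ... | inj₁ px  = x , px
  ... | inj₂ pxs = any-true⁻ xs pxs

  any-false⁻ : ∀ xs → any p xs ≡ false → All (λ x → p x ≡ false) xs
  any-false⁻ []     _ = []
  any-false⁻ (x ∷ xs) e with ∨-false⁻ e
  ... | px , pxs = px ∷ any-false⁻ xs pxs

infix 4 _≼_

data _≼_ : Rank → ℕ → Set where
  fin≤ : ∀ {r α} → r ≤ α → fin r ≼ α

≼-weaken : ∀ {R α β} → α ≤ β → R ≼ α → R ≼ β
≼-weaken α≤β (fin≤ r≤α) = fin≤ (≤-trans r≤α α≤β)

∞⋠ : ∀ {α} → ¬ (∞ ≼ α)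
∞⋠ ()

∞≢fin : ∀ {r} → ¬ (∞ ≡ fin r)
∞≢fin ()

fin-unique : ∀ {R a b} → R ≡ fin a → R ≡ fin b → a ≡ b
fin-unique refl refl = refl

module _ {A : Set} (g : A → Rank) where

  maxR-bounded : ∀ xs {α} → foldr maxR (fin 0) (map g xs) ≡ fin α → All (λ x → g x ≼ α) xs
  maxR-bounded []       _ = []
  maxR-bounded (x ∷ xs) e with g x in gx | foldr maxR (fin 0) (map g xs) in e′ | e
  ... | fin a | fin b | refl =
    subst (_≼ (a ⊔ b)) (sym gx) (fin≤ (m≤m⊔n a b)) ∷
    All.map (≼-weaken (m≤n⊔m a b)) (maxR-bounded xs e′)
  ... | fin _ | ∞     | ()
  ... | ∞     | _     | ()

  maxR-attained : ∀ xs {α} → foldr maxR (fin 0) (map g xs) ≡ fin α → 0 < α → ∃ λ x → g x ≡ fin α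
  maxR-attained []       refl ()
  maxR-attained (x ∷ xs) e α>0 with g x in gx | foldr maxR (fin 0) (map g xs) in e′ | e
  ... | fin a | fin b | refl with ⊔-sel a b
  ...   | inj₁ a⊔b≡a = x , trans gx (cong fin (sym a⊔b≡a))
  ...   | inj₂ a⊔b≡b =
    let y , gy = maxR-attained xs e′ (subst (0 <_) a⊔b≡b α>0) in y , trans gy (cong fin (sym a⊔b≡b))
  maxR-attained (x ∷ xs) e α>0 | fin _ | ∞ | ()
  maxR-attained (x ∷ xs) e α>0 | ∞     | _ | ()

module Corners {n : ℕ} (G : Graph n) where

  Dominates : Subset n → Fin n → Fin n → Set
  Dominates S v w = ∀ {u} → S u ≡ true → adj G v u ≡ true → adj G w u ≡ true

  StrictlyCorners : Subset n → Fin n → Fin n → Set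
  StrictlyCorners S w v =
    Dominates S v w × ∃ λ u → S u ≡ true × adj G w u ≡ true × adj G v u ≡ false

  Dominates-trans : ∀ {S u v w} → Dominates S u v → Dominates S v w → Dominates S u w
  Dominates-trans d d′ su a = d′ su (d su a)

  Universal : Subset n → Fin n → Set
  Universal S v = ∀ {u} → S u ≡ true → adj G v u ≡ true

  -- If S is the vertex set of G^(k), this is that of G^(k+1), exactly as rankFrom computes it.
  removeStrictCorners : Subset n → Subset n
  removeStrictCorners S u = S u ∧ not (isStrictCorner G S u)

  isClique⁻ : ∀ {S a b} → isClique G S ≡ true → S a ≡ true → S b ≡ true → adj G a b ≡ true
  isClique⁻ {a = a} {b} e sa sb =
    ⇒-true⁻ (All.lookup (all-true⁻ (allFin n) (All.lookup (all-true⁻ (allFin n) e) (∈-allFin a)))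
                        (∈-allFin b))
            (cong₂ _∧_ sa sb)

  module _ (S : Subset n) where

    nbhdSub⁻ : ∀ {v w} → nbhdSub G S v w ≡ true → Dominates S v w
    nbhdSub⁻ e {u} su avu =
      proj₂ (∧-true⁻ (⇒-true⁻ (All.lookup (all-true⁻ (allFin n) e) (∈-allFin u)) (cong₂ _∧_ su avu)))

    nbhdSub⁺ : ∀ {v w} → Dominates S v w → nbhdSub G S v w ≡ true
    nbhdSub⁺ d = all-true⁺ (allFin n) λ u → ⇒-true⁺ λ e →
      let su , avu = ∧-true⁻ e in cong₂ _∧_ su (d su avu)

    nbhdSub-false⁻ : ∀ {v w} → nbhdSub G S v w ≡ false →
      ∃ λ u → S u ≡ true × adj G v u ≡ true × adj G w u ≡ false
    nbhdSub-false⁻ e with all-false⁻ (allFin n) e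
    ... | u , e′ with ⇒-false⁻ e′
    ...   | inV , ∉W with ∧-true⁻ inV
    ...     | su , avu = u , su , avu , true-∧-false⁻ su ∉W

    isStrictCorner⁻ : ∀ {v} → isStrictCorner G S v ≡ true →
      S v ≡ true × ∃ λ w → S w ≡ true × StrictlyCorners S w v
    isStrictCorner⁻ e with ∧-true⁻ e
    ... | sv , e′ with any-true⁻ (allFin n) e′
    ...   | w , e″ with ∧-true⁻ e″
    ...     | sw , e‴ with ∧-true⁻ e‴
    ...       | vw , ¬wv with nbhdSub-false⁻ (not-true⁻ ¬wv)
    ...         | u , su , awu , avu = sv , w , sw , nbhdSub⁻ vw , u , su , awu , avu

    nonCorner-maximal : ∀ {x w} → S x ≡ true → isStrictCorner G S x ≡ false →
      S w ≡ true → Dominates S x w → Dominates S w x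
    nonCorner-maximal {x} {w} sx cx sw d =
      nbhdSub⁻ (not-false⁻ (true-∧-false⁻ (nbhdSub⁺ d) (true-∧-false⁻ sw
        (All.lookup (any-false⁻ (allFin n) (true-∧-false⁻ sx cx)) (∈-allFin w)))))

    nbhd : Fin n → Sub.Subset n
    nbhd v = tabulate (inN G S v)

    ∈-nbhd⁺ : ∀ {v u} → S u ≡ true → adj G v u ≡ true → u ∈ nbhd v
    ∈-nbhd⁺ {v} {u} su avu = lookup⇒[]= u _ (trans (lookup∘tabulate (inN G S v) u) (cong₂ _∧_ su avu))

    ∈-nbhd⁻ : ∀ {v u} → u ∈ nbhd v → S u ≡ true × adj G v u ≡ true
    ∈-nbhd⁻ {v} {u} u∈ = ∧-true⁻ (trans (sym (lookup∘tabulate (inN G S v) u)) ([]=⇒lookup u∈))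

    strictlyCorners⇒nbhd-⊂ : ∀ {w v} → StrictlyCorners S w v → nbhd v ⊂ nbhd w
    strictlyCorners⇒nbhd-⊂ (d , u , su , awu , avu) =
      (λ u∈ → let su′ , a = ∈-nbhd⁻ u∈ in ∈-nbhd⁺ su′ (d su′ a)) ,
      u , ∈-nbhd⁺ su awu , λ u∈ → ≡true⇒≢false (proj₂ (∈-nbhd⁻ u∈)) avu

    -- Strict cornering strictly enlarges the closed neighbourhood, so it is
    -- well-founded; its maximal elements are the non-corners.
    codegree : Fin n → ℕ
    codegree v = n ∸ ∣ nbhd v ∣

    strictlyCorners⇒codegree-< : ∀ {w v} → StrictlyCorners S w v → codegree w < codegree v
    strictlyCorners⇒codegree-< c = ∸-monoʳ-< (p⊂q⇒∣p∣<∣q∣ (strictlyCorners⇒nbhd-⊂ c)) (∣p∣≤n (nbhd _))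

    dominated-by-nonCorner : ∀ {v} → S v ≡ true →
      ∃ λ w → S w ≡ true × isStrictCorner G S w ≡ false × Dominates S v w
    dominated-by-nonCorner {v} = go v (On.wellFounded codegree <-wellFounded v)
      where
      go : ∀ v → Acc (_<_ on codegree) v → S v ≡ true →
        ∃ λ w → S w ≡ true × isStrictCorner G S w ≡ false × Dominates S v w
      go v (acc rec) sv with isStrictCorner G S v in cv
      ... | false = v , sv , cv , λ _ a → a
      ... | true with isStrictCorner⁻ cv
      ...   | _ , w , sw , c with go w (rec (strictlyCorners⇒codegree-< c)) sw
      ...     | w′ , sw′ , cw′ , d = w′ , sw′ , cw′ , Dominates-trans (proj₁ c) d

    removeStrictCorners⁺ : ∀ {u} → S u ≡ true → isStrictCorner G S u ≡ false →
      removeStrictCorners S u ≡ true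
    removeStrictCorners⁺ su cu = cong₂ _∧_ su (cong not cu)

    removeStrictCorners⁻ : ∀ {u} → removeStrictCorners S u ≡ true →
      S u ≡ true × isStrictCorner G S u ≡ false
    removeStrictCorners⁻ e = let su , ¬cu = ∧-true⁻ e in su , not-true⁻ ¬cu

    universal⇒¬strictlyCornered : ∀ {v w} → Universal S v → ¬ StrictlyCorners S w v
    universal⇒¬strictlyCornered uv (_ , _ , su , _ , avu) = ≡true⇒≢false (uv su) avu

    universal-spreads-to-nonCorners : ∀ {w x} → S w ≡ true → Universal S w →
      S x ≡ true → isStrictCorner G S x ≡ false → Universal S x
    universal-spreads-to-nonCorners sw uw sx cx su =
      nonCorner-maximal sx cx sw (λ su′ _ → uw su′) su (uw su)

    module _ (K : isClique G (removeStrictCorners S) ≡ true) {v : Fin n}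
             (adj-corners : ∀ {u} → isStrictCorner G S u ≡ true → adj G v u ≡ true) where

      nonCorner-above-universal : ∀ {w} → S w ≡ true → isStrictCorner G S w ≡ false →
        Dominates S v w → Universal S w
      nonCorner-above-universal sw cw d {u} su with true-or-false (isStrictCorner G S u)
      ... | inj₁ cu = d su (adj-corners cu)
      ... | inj₂ cu = isClique⁻ K (removeStrictCorners⁺ sw cw) (removeStrictCorners⁺ su cu)

      universal-if-nonCorner-universal : S v ≡ true → ∀ {w} → S w ≡ true →
        isStrictCorner G S w ≡ false → Universal S w → Universal S v
      universal-if-nonCorner-universal sv sw cw uw {u} su with true-or-false (isStrictCorner G S u)
      ... | inj₁ cu = adj-corners cu
      ... | inj₂ cu = trans (adj-sym G v u) (universal-spreads-to-nonCorners sw uw su cu sv)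

    strictCorner-has-nonadjacent-corner : isClique G (removeStrictCorners S) ≡ true →
      ∀ {v} → isStrictCorner G S v ≡ true →
      ∃ λ u → isStrictCorner G S u ≡ true × adj G v u ≡ false
    strictCorner-has-nonadjacent-corner K {v} cv
      with any? (λ u → (isStrictCorner G S u ≟ true) ×-dec (adj G v u ≟ false))
    ... | yes found = found
    ... | no none with isStrictCorner⁻ cv
    ...   | sv , w₀ , sw₀ , c with dominated-by-nonCorner sw₀
    ...     | w , sw , cw , d =
      ⊥-elim (universal⇒¬strictlyCornered
        (universal-if-nonCorner-universal K adj-corners sv sw cw
          (nonCorner-above-universal K adj-corners sw cw (Dominates-trans (proj₁ c) d)))
        c)
      where
      adj-corners : ∀ {u} → isStrictCorner G S u ≡ true → adj G v u ≡ true
      adj-corners cu = ¬-not λ nadj → none (_ , cu , nadj)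

module Ranking {n : ℕ} (G : Graph n) where
  open Corners G

  data Stage (f k : ℕ) (S : Subset n) : Set where
    clique : isClique G S ≡ true → (∀ u → rankFrom G (suc f) k S u ≡ fin k) → Stage f k S
    stuck  : (∀ u → rankFrom G (suc f) k S u ≡ ∞) → Stage f k S
    peel   : (∀ {u} → isStrictCorner G S u ≡ true → rankFrom G (suc f) k S u ≡ fin k) →
             (∀ {u} → isStrictCorner G S u ≡ false →
                rankFrom G (suc f) k S u ≡ rankFrom G f (suc k) (removeStrictCorners S) u) →
             Stage f k S

  stage : ∀ f k S → Stage f k S
  stage f k S with isClique G S in cq | hasStrictCorner G S in hs
  ... | true  | _     = clique cq rank-clique
    where rank-clique : ∀ u → rankFrom G (suc f) k S u ≡ fin k
          rank-clique u rewrite cq = refl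
  ... | false | false = stuck rank-stuck
    where rank-stuck : ∀ u → rankFrom G (suc f) k S u ≡ ∞
          rank-stuck u rewrite cq | hs = refl
  ... | false | true  = peel rank-corner rank-nonCorner
    where
    rank-corner : ∀ {u} → isStrictCorner G S u ≡ true → rankFrom G (suc f) k S u ≡ fin k
    rank-corner cu rewrite cq | hs | cu = refl
    rank-nonCorner : ∀ {u} → isStrictCorner G S u ≡ false →
      rankFrom G (suc f) k S u ≡ rankFrom G f (suc k) (removeStrictCorners S) u
    rank-nonCorner cu rewrite cq | hs | cu = refl

  rank-≥-stage : ∀ f k S u {r} → rankFrom G f k S u ≡ fin r → k ≤ r
  rank-≥-stage zero    k S u ()
  rank-≥-stage (suc f) k S u e with stage f k S
  ... | clique _ rk = ≤-reflexive (fin-unique (rk u) e)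
  ... | stuck rk    = ⊥-elim (∞≢fin (trans (sym (rk u)) e))
  ... | peel corner rest with true-or-false (isStrictCorner G S u)
  ...   | inj₁ cu = ≤-reflexive (fin-unique (corner cu) e)
  ...   | inj₂ cu = <⇒≤ (rank-≥-stage f (suc k) _ u (trans (sym (rest cu)) e))

  bounded⇒stage-≤ : ∀ {f k S u α} → rankFrom G f k S u ≼ α → k ≤ α
  bounded⇒stage-≤ {f} {k} {S} {u} b with rankFrom G f k S u in e | b
  ... | fin r | fin≤ r≤α = ≤-trans (rank-≥-stage f k S u e) r≤α
  ... | ∞     | ()

  peel-preserves-bound : ∀ f k S {α} →
    (∀ {u} → isStrictCorner G S u ≡ false →
       rankFrom G (suc f) k S u ≡ rankFrom G f (suc k) (removeStrictCorners S) u) →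
    (∀ {u} → S u ≡ true → rankFrom G (suc f) k S u ≼ α) →
    ∀ {u} → removeStrictCorners S u ≡ true → rankFrom G f (suc k) (removeStrictCorners S) u ≼ α
  peel-preserves-bound f k S {α} rest bound tu =
    let su , cu = removeStrictCorners⁻ S tu in subst (_≼ α) (rest cu) (bound su)

  -- Otherwise the non-corners of T would be ranked after stage k.
  bounded-stage-isClique : ∀ f k T {x} → T x ≡ true →
    (∀ {u} → T u ≡ true → rankFrom G f k T u ≼ k) → isClique G T ≡ true
  bounded-stage-isClique zero    k T tx bound = ⊥-elim (∞⋠ (bound tx))
  bounded-stage-isClique (suc f) k T tx bound with stage f k T
  ... | clique K _ = K
  ... | stuck rk   = ⊥-elim (∞⋠ (subst (_≼ k) (rk _) (bound tx)))
  ... | peel _ rest with dominated-by-nonCorner T tx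
  ...   | y , ty , cy , _ =
    ⊥-elim (<-irrefl refl (bounded⇒stage-≤ {f} {suc k} (subst (_≼ k) (rest cy) (bound ty))))

  nonadjacent-of-same-rank : ∀ f k S a {v x} → rankFrom G f k S v ≡ fin a →
    S x ≡ true → rankFrom G f k S x ≡ fin (suc a) →
    (∀ {u} → S u ≡ true → rankFrom G f k S u ≼ suc a) →
    ∃ λ u → S u ≡ true × rankFrom G f k S u ≡ fin a × adj G v u ≡ false
  nonadjacent-of-same-rank zero k S a () sx rx bound
  nonadjacent-of-same-rank (suc f) k S a {v} {x} rv sx rx bound with stage f k S
  ... | clique _ rk = ⊥-elim (1+n≢n (trans (sym (fin-unique (rk x) rx)) (fin-unique (rk v) rv)))
  ... | stuck rk    = ⊥-elim (∞≢fin (trans (sym (rk v)) rv))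
  ... | peel corner rest with true-or-false (isStrictCorner G S v) | true-or-false (isStrictCorner G S x)
  ...   | inj₁ cv | inj₁ cx =
    ⊥-elim (1+n≢n (trans (sym (fin-unique (corner cx) rx)) (fin-unique (corner cv) rv)))
  ...   | inj₂ cv | inj₁ cx =
    ⊥-elim (1+n≰n (≤-trans (n≤1+n _)
      (subst (λ j → suc j ≤ a) (fin-unique (corner cx) rx)
        (rank-≥-stage f (suc k) _ v (trans (sym (rest cv)) rv)))))
  ...   | inj₂ cv | inj₂ cx =
    let u , tu , ru , avu =
          nonadjacent-of-same-rank f (suc k) (removeStrictCorners S) a (trans (sym (rest cv)) rv)
            (removeStrictCorners⁺ S sx cx) (trans (sym (rest cx)) rx)
            (peel-preserves-bound f k S rest bound)
        su , cu = removeStrictCorners⁻ S tu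
    in u , su , trans (rest cu) ru , avu
  ...   | inj₁ cv | inj₂ cx with fin-unique (corner cv) rv
  ...     | refl =
    let K = bounded-stage-isClique f (suc k) (removeStrictCorners S) (removeStrictCorners⁺ S sx cx)
              (peel-preserves-bound f k S rest bound)
        u , cu , avu = strictCorner-has-nonadjacent-corner S K cv
    in u , proj₁ (isStrictCorner⁻ S cu) , corner cu , avu

lemma3p18 : (m : ℕ) (G : Graph (suc m)) (α : ℕ) →
    cornerRank G ≡ fin α → 2 ≤ α →
    (v : Fin (suc m)) → rank G v ≡ fin (α ∸ 1) →
    Σ (Fin (suc m)) (λ u → (rank G u ≡ fin (α ∸ 1)) × (adj G v u ≡ false))
lemma3p18 m G (suc a) cr (s≤s _) v rv =
  let x , rx = maxR-attained (rank G) (allFin (suc m)) cr (s≤s z≤n)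
      bounded = maxR-bounded (rank G) (allFin (suc m)) cr
      u , _ , ru , avu = Ranking.nonadjacent-of-same-rank G (suc (suc m)) 1 (λ _ → true) a rv refl rx
                           λ {u} _ → All.lookup bounded (∈-allFin u)
  in u , ru , avu
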